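{- Let $\mathbf{L}$ be a complete residuated lattice, $F$ a type (set of function symbols with finite arities), $X$ a set of variables with $T_F(X)\neq\emptyset$, and let $\Sigma\colon T_F(X)\times T_F(X)\to L$ be an $\mathbf{L}$-set of inequalities. Then the syntactic closure of $\Sigma$ is contained in the semantic closure of $\Sigma$, i.e. $\Sigma^{\mathrm{syn}}(t,t')\le \Sigma^{\mathrm{sem}}(t,t')$ for all $t,t'\in T_F(X)$.
   Context: A complete residuated lattice is $\mathbf{L}=\langle L,\wedge,\vee,\otimes,\rightarrow,0,1\rangle$ where $\langle L,\wedge,\vee,0,1\rangle$ is a complete lattice, $\langle L,\otimes,1\rangle$ is a commutative monoid, and $a\otimes b\le c$ iff $a\le b\rightarrow c$. An $\mathbf{L}$-set in $M$ is a map $M\to L$; for $\mathbf{L}$-sets, $A_1\subseteq A_2$ means pointwise $\le$, and intersections are pointwise infima. An algebra with $\mathbf{L}$-order of type $F$ is $\mathbf{M}=\langle M,\preccurlyeq^{\mathbf{M}},F^{\mathbf{M}}\rangle$ where $\langle M,F^{\mathbf{M}}\rangle$ is an algebra of type $F$ and $\preccurlyeq^{\mathbf{M}}\colon M\times M\to L$ satisfies: (i) $a\preccurlyeq^{\mathbf{M}} b=b\preccurlyeq^{\mathbf{M}} a=1$ iff $a=b$; (ii) $(a\preccurlyeq^{\mathbf{M}} b)\otimes(b\preccurlyeq^{\mathbf{M}} c)\le a\preccurlyeq^{\mathbf{M}} c$; (iii) $(a_1\preccurlyeq^{\mathbf{M}} b_1)\otimes\cdots\otimes(a_n\preccurlyeq^{\mathbf{M}}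 b_n)\le f^{\mathbf{M}}(a_1,\dots,a_n)\preccurlyeq^{\mathbf{M}} f^{\mathbf{M}}(b_1,\dots,b_n)$ for every $n$-ary $f\in F$ and all elements. $T_F(X)$ is the set of terms over $F$ and $X$. Formulas (inequalities) $t\preccurlyeq t'$ are identified with pairs $\langle t,t'\rangle\in T_F(X)\times T_F(X)$. For a map $v\colon X\to M$, $\|t\|_{\mathbf{M},v}$ is the usual value of $t$ in $\mathbf{M}$ under $v$, and $\|t\preccurlyeq t'\|_{\mathbf{M},v}=\|t\|_{\mathbf{M},v}\preccurlyeq^{\mathbf{M}}\|t'\|_{\mathbf{M},v}$; $\|t\preccurlyeq t'\|_{\mathbf{M}}=\bigwedge_{v\colon X\to M}\|t\preccurlyeq t'\|_{\mathbf{M},v}$. $\mathbf{M}$ is a model of $\Sigma$ if $\Sigma(t,t')\le\|t\preccurlyeq t'\|_{\mathbf{M}}$ for all $t,t'$. The degree of semantic entailment is $\|t\preccurlyeq t'\|_{\Sigma}=\bigwedge\{\|t\preccurlyeq t'\|_{\mathbf{M}}:\mathbf{M}\text{ a model of }\Sigma\}$. $\Sigma'$ is semantically closed if $\|t\preccurlyeq t'\|_{\Sigma'}\le\Sigma'(t,t')$ for all $t,t'$; the semantic closure $\Sigma^{\mathrm{sem}}$ is the intersection of all semantically closed $\Sigma'$ with $\Sigma\subseteq\Sigma'$. $\Sigma'$ is syntactically closed if for all $t,t',t'',t_i,t_i'\in T_F(X)$, every $n$-ary $f\in F$, and every homomorphism $h$ of the term algebra (i.e. every substitution map $T_F(X)\to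 T_F(X)$ obtained by replacing each variable $x$ by a term $h(x)$): $\Sigma'(t,t)=1$; $\Sigma'(t,t')\otimes\Sigma'(t',t'')\le\Sigma'(t,t'')$; $\Sigma'(t_1,t_1')\otimes\cdots\otimes\Sigma'(t_n,t_n')\le\Sigma'(f(t_1,\dots,t_n),f(t_1',\dots,t_n'))$; $\Sigma'(t,t')\le\Sigma'(h(t),h(t'))$. The syntactic closure $\Sigma^{\mathrm{syn}}$ is the intersection of all syntactically closed $\Sigma'$ with $\Sigma\subseteq\Sigma'$. -}

module Defs where

open import Level using (Level; _⊔_; suc; Setω)
open import Data.Nat using (ℕ; zero) renaming (suc to sucℕ)
open import Data.Vec using (Vec; []; _∷_)
open import Data.Product using (Σ; _×_; _,_)
open import Relation.Binary.PropositionalEquality using (_≡_)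
open import Relation.Binary.Structures using (IsPartialOrder)
open import Algebra.Structures using (IsCommutativeMonoid)
open import Function.Bundles using (_⇔_)

-- Complete residuated lattices.
-- Completeness: infima and suprema of arbitrary families (indexed by a
-- type of any universe level), hence the record lives in Setω.

record CompleteResiduatedLattice (c ℓ : Level) : Setω where
  infixr 7 _⊗_
  infixr 5 _⇒_
  infixr 6 _∧_
  infixr 6 _∨_
  infix 4 _≤_
  field
    Carrier        : Set c
    _≤_            : Carrier → Carrier → Set ℓ
    isPartialOrder : IsPartialOrder _≡_ _≤_
    _∧_ _∨_ _⊗_ _⇒_ : Carrier → Carrier → Carrier
    𝟘 𝟙            : Carrier
    ∧-lbˡ  : ∀ a b → a ∧ b ≤ a
    ∧-lbʳ  : ∀ a b → a ∧ b ≤ b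
    ∧-glb  : ∀ a b d → d ≤ a → d ≤ b → d ≤ a ∧ b
    ∨-ubˡ  : ∀ a b → a ≤ a ∨ b
    ∨-ubʳ  : ∀ a b → b ≤ a ∨ b
    ∨-lub  : ∀ a b d → a ≤ d → b ≤ d → a ∨ b ≤ d
    𝟘-min  : ∀ a → 𝟘 ≤ a
    𝟙-max  : ∀ a → a ≤ 𝟙
    ⋀      : ∀ {ι} {I : Set ι} → (I → Carrier) → Carrier
    ⋀-lb   : ∀ {ι} {I : Set ι} (g : I → Carrier) (i : I) → ⋀ g ≤ g i
    ⋀-glb  : ∀ {ι} {I : Set ι} (g : I → Carrier) (d : Carrier) →
             (∀ i → d ≤ g i) → d ≤ ⋀ g
    ⋁      : ∀ {ι} {I : Set ι} → (I → Carrier) → Carrier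
    ⋁-ub   : ∀ {ι} {I : Set ι} (g : I → Carrier) (i : I) → g i ≤ ⋁ g
    ⋁-lub  : ∀ {ι} {I : Set ι} (g : I → Carrier) (d : Carrier) →
             (∀ i → g i ≤ d) → ⋁ g ≤ d
    ⊗-isCommutativeMonoid : IsCommutativeMonoid _≡_ _⊗_ 𝟙
    residuation : ∀ a b d → (a ⊗ b ≤ d) ⇔ (a ≤ b ⇒ d)

record Signature (f : Level) : Set (suc f) where
  field
    Sym   : Set f
    arity : Sym → ℕ

open Signature public

data Term {f x} (F : Signature f) (X : Set x) : Set (f ⊔ x) where
  var : X → Term F X
  app : (s : Sym F) → Vec (Term F X) (arity F s) → Term F X

module _ {f x} {F : Signature f} {X : Set x} where

  -- substitutions = endomorphisms of the term algebra
  mutual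
    subst : (X → Term F X) → Term F X → Term F X
    subst h (var y)    = h y
    subst h (app s ts) = app s (substs h ts)

    substs : ∀ {n} → (X → Term F X) → Vec (Term F X) n → Vec (Term F X) n
    substs h []       = []
    substs h (t ∷ ts) = subst h t ∷ substs h ts

module _ {c ℓ} (𝐋 : CompleteResiduatedLattice c ℓ) where
  open CompleteResiduatedLattice 𝐋

  ⊗-zip : ∀ {a} {A B : Set a} {n} → (A → B → Carrier) →
          Vec A n → Vec B n → Carrier
  ⊗-zip R []       []       = 𝟙
  ⊗-zip R (a ∷ as) (b ∷ bs) = R a b ⊗ ⊗-zip R as bs

  record LOrderedAlgebra {f} (F : Signature f) (m : Level)
         : Set (suc m ⊔ f ⊔ c ⊔ ℓ) where
    field
      M    : Set m
      _≼_  : M → M → Carrier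
      ⟦_⟧  : (s : Sym F) → Vec M (arity F s) → M
      ≼-antisym-refl : ∀ a b → ((a ≼ b ≡ 𝟙) × (b ≼ a ≡ 𝟙)) ⇔ (a ≡ b)
      ≼-trans  : ∀ a b d → (a ≼ b) ⊗ (b ≼ d) ≤ a ≼ d
      ≼-compat : ∀ (s : Sym F) (as bs : Vec M (arity F s)) →
                 ⊗-zip _≼_ as bs ≤ ⟦ s ⟧ as ≼ ⟦ s ⟧ bs

  module _ {f x} {F : Signature f} {X : Set x} where

    module _ {m} (𝐌 : LOrderedAlgebra F m) where
      open LOrderedAlgebra 𝐌
      mutual
        eval : (X → M) → Term F X → M
        eval v (var y)    = v y
        eval v (app s ts) = ⟦ s ⟧ (evals v ts)

        evals : ∀ {n} → (X → M) → Vec (Term F X) n → Vec M n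
        evals v []       = []
        evals v (t ∷ ts) = eval v t ∷ evals v ts

      ‖_≼_‖[_] : Term F X → Term F X → (X → M) → Carrier
      ‖ t ≼ t' ‖[ v ] = eval v t ≼ eval v t'

      ‖_≼_‖ : Term F X → Term F X → Carrier
      ‖ t ≼ t' ‖ = ⋀ (λ (v : X → M) → ‖ t ≼ t' ‖[ v ])

    LSetIneq : Set (c ⊔ f ⊔ x)
    LSetIneq = Term F X → Term F X → Carrier

    _⊆_ : LSetIneq → LSetIneq → Set (ℓ ⊔ f ⊔ x)
    Σ₁ ⊆ Σ₂ = ∀ t t' → Σ₁ t t' ≤ Σ₂ t t'

    IsModel : ∀ {m} → LOrderedAlgebra F m → LSetIneq → Set (ℓ ⊔ f ⊔ x)
    IsModel 𝐌 Σ' = ∀ t t' → Σ' t t' ≤ ‖_≼_‖ 𝐌 t t'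

    semEnt : (m : Level) → LSetIneq → Term F X → Term F X → Carrier
    semEnt m Σ' t t' =
      ⋀ (λ (p : Σ (LOrderedAlgebra F m) (λ 𝐌 → IsModel 𝐌 Σ')) →
           let (𝐌 , _) = p in ‖_≼_‖ 𝐌 t t')

    SemClosed : (m : Level) → LSetIneq → Set (ℓ ⊔ f ⊔ x)
    SemClosed m Σ' = ∀ t t' → semEnt m Σ' t t' ≤ Σ' t t'

    semClosure : (m : Level) → LSetIneq → LSetIneq
    semClosure m Σ₀ t t' =
      ⋀ (λ (p : Σ LSetIneq (λ Σ' → SemClosed m Σ' × (Σ₀ ⊆ Σ'))) →
           let (Σ' , _) = p in Σ' t t')

    SynClosed : LSetIneq → Set (c ⊔ ℓ ⊔ f ⊔ x)
    SynClosed Σ' =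
      (∀ t → Σ' t t ≡ 𝟙) ×
      (∀ t t' t'' → Σ' t t' ⊗ Σ' t' t'' ≤ Σ' t t'') ×
      (∀ (s : Sym F) (ts ts' : Vec (Term F X) (arity F s)) →
         ⊗-zip Σ' ts ts' ≤ Σ' (app s ts) (app s ts')) ×
      (∀ (h : X → Term F X) t t' → Σ' t t' ≤ Σ' (subst h t) (subst h t'))

    synClosure : LSetIneq → LSetIneq
    synClosure Σ₀ t t' =
      ⋀ (λ (p : Σ LSetIneq (λ Σ' → SynClosed Σ' × (Σ₀ ⊆ Σ'))) →
           let (Σ' , _) = p in Σ' t t')

-- Each closure rule defining syntactic closedness is sound in every algebra with
-- 𝐋-order (reflexivity and transitivity of ≼, compatibility of the operations,
-- and the substitution lemma for evaluation).  Hence every semantically closed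
-- Σ' ⊇ Σ is syntactically closed, so Σ^syn is the meet of a larger family of
-- 𝐋-sets than Σ^sem.
module Submission where

open import Level using (Level)
open import Data.Vec using (Vec; []; _∷_)
open import Data.Product using (Σ; _,_; proj₁)
open import Relation.Binary.PropositionalEquality using (_≡_; refl; sym; cong; cong₂; subst₂)
open import Relation.Binary.Structures using (IsPartialOrder)
open import Algebra.Structures using (IsCommutativeMonoid)
open import Function.Bundles using (Equivalence)
open import Defs

module _ {c ℓ} (𝐋 : CompleteResiduatedLattice c ℓ) where
  open CompleteResiduatedLattice 𝐋
  open IsPartialOrder isPartialOrder
    using () renaming (refl to ≤-refl; reflexive to ≤-reflexive; trans to ≤-trans; antisym to ≤-antisym)
  open IsCommutativeMonoid ⊗-isCommutativeMonoid using () renaming (comm to ⊗-comm)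

  ⋀-antitone : ∀ {ι κ} {I : Set ι} {J : Set κ} (g : I → Carrier) (h : J → Carrier) →
               (∀ j → Σ I λ i → g i ≤ h j) → ⋀ g ≤ ⋀ h
  ⋀-antitone g h cover = ⋀-glb h (⋀ g) λ j →
    let (i , gi≤hj) = cover j in ≤-trans (⋀-lb g i) gi≤hj

  ⊗-monoˡ : ∀ {a a'} b → a ≤ a' → a ⊗ b ≤ a' ⊗ b
  ⊗-monoˡ {a} {a'} b a≤a' = Equivalence.from (residuation a b (a' ⊗ b))
    (≤-trans a≤a' (Equivalence.to (residuation a' b (a' ⊗ b)) ≤-refl))

  ⊗-monoʳ : ∀ a {b b'} → b ≤ b' → a ⊗ b ≤ a ⊗ b'
  ⊗-monoʳ a {b} {b'} b≤b' = subst₂ _≤_ (⊗-comm b a) (⊗-comm b' a) (⊗-monoˡ a b≤b')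

  ⊗-mono : ∀ {a a' b b'} → a ≤ a' → b ≤ b' → a ⊗ b ≤ a' ⊗ b'
  ⊗-mono {a' = a'} a≤a' b≤b' = ≤-trans (⊗-monoˡ _ a≤a') (⊗-monoʳ a' b≤b')

  ≼-refl : ∀ {f m} {F : Signature f} (𝐌 : LOrderedAlgebra 𝐋 F m) a →
           LOrderedAlgebra._≼_ 𝐌 a a ≡ 𝟙
  ≼-refl 𝐌 a = proj₁ (Equivalence.from (LOrderedAlgebra.≼-antisym-refl 𝐌 a a) refl)

  module _ {f x} {F : Signature f} {X : Set x} {m} (𝐌 : LOrderedAlgebra 𝐋 F m) where
    open LOrderedAlgebra 𝐌

    mutual
      eval-subst : ∀ (v : X → M) (h : X → Term F X) t →
                   eval 𝐋 𝐌 v (subst h t) ≡ eval 𝐋 𝐌 (λ y → eval 𝐋 𝐌 v (h y)) t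
      eval-subst v h (var y)    = refl
      eval-subst v h (app s ts) = cong ⟦ s ⟧ (evals-substs v h ts)

      evals-substs : ∀ {n} (v : X → M) (h : X → Term F X) (ts : Vec (Term F X) n) →
                     evals 𝐋 𝐌 v (substs h ts) ≡ evals 𝐋 𝐌 (λ y → eval 𝐋 𝐌 v (h y)) ts
      evals-substs v h []       = refl
      evals-substs v h (t ∷ ts) = cong₂ _∷_ (eval-subst v h t) (evals-substs v h ts)

    module _ {Σ' : LSetIneq 𝐋 {F = F} {X = X}} (model : IsModel 𝐋 𝐌 Σ') where

      model-sound : ∀ v t t' → Σ' t t' ≤ ‖_≼_‖[_] 𝐋 𝐌 t t' v
      model-sound v t t' = ≤-trans (model t t') (⋀-lb _ v)

      model-sound-⊗-zip : ∀ {n} v (ts ts' : Vec (Term F X) n) →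
                          ⊗-zip 𝐋 Σ' ts ts' ≤ ⊗-zip 𝐋 _≼_ (evals 𝐋 𝐌 v ts) (evals 𝐋 𝐌 v ts')
      model-sound-⊗-zip v []       []         = ≤-refl
      model-sound-⊗-zip v (t ∷ ts) (t' ∷ ts') =
        ⊗-mono (model-sound v t t') (model-sound-⊗-zip v ts ts')

  module _ {f x} {F : Signature f} {X : Set x} {m : Level}
           {Σ' : LSetIneq 𝐋 {F = F} {X = X}} (closed : SemClosed 𝐋 m Σ') where

    semClosed-intro : ∀ {a} t t' →
      (∀ (𝐌 : LOrderedAlgebra 𝐋 F m) → IsModel 𝐋 𝐌 Σ' → ∀ v → a ≤ ‖_≼_‖[_] 𝐋 𝐌 t t' v) →
      a ≤ Σ' t t'
    semClosed-intro t t' valid = ≤-trans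
      (⋀-glb _ _ λ { (𝐌 , model) → ⋀-glb _ _ (valid 𝐌 model) })
      (closed t t')

    semClosed⇒synClosed : SynClosed 𝐋 Σ'
    semClosed⇒synClosed = reflexive , transitive , compatible , substitutive
      where
      reflexive : ∀ t → Σ' t t ≡ 𝟙
      reflexive t = ≤-antisym (𝟙-max _) (semClosed-intro t t λ 𝐌 _ v →
        ≤-reflexive (sym (≼-refl 𝐌 _)))

      transitive : ∀ t t' t'' → Σ' t t' ⊗ Σ' t' t'' ≤ Σ' t t''
      transitive t t' t'' = semClosed-intro t t'' λ 𝐌 model v →
        ≤-trans (⊗-mono (model-sound 𝐌 model v t t') (model-sound 𝐌 model v t' t''))
                (LOrderedAlgebra.≼-trans 𝐌 _ _ _)

      compatible : ∀ s (ts ts' : Vec (Term F X) (arity F s)) →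
                   ⊗-zip 𝐋 Σ' ts ts' ≤ Σ' (app s ts) (app s ts')
      compatible s ts ts' = semClosed-intro (app s ts) (app s ts') λ 𝐌 model v →
        ≤-trans (model-sound-⊗-zip 𝐌 model v ts ts') (LOrderedAlgebra.≼-compat 𝐌 s _ _)

      substitutive : ∀ h t t' → Σ' t t' ≤ Σ' (subst h t) (subst h t')
      substitutive h t t' = semClosed-intro (subst h t) (subst h t') λ 𝐌 model v →
        ≤-trans (model-sound 𝐌 model _ t t')
          (≤-reflexive (sym (cong₂ (LOrderedAlgebra._≼_ 𝐌) (eval-subst 𝐌 v h t) (eval-subst 𝐌 v h t'))))

lemma1 : ∀ {c ℓ f x : Level} (𝐋 : CompleteResiduatedLattice c ℓ)
           (F : Signature f) (X : Set x) →
           Term F X →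
           (Σ₀ : LSetIneq 𝐋 {F = F} {X = X}) →
           ∀ (m : Level) (t t' : Term F X) →
           CompleteResiduatedLattice._≤_ 𝐋
             (synClosure 𝐋 Σ₀ t t') (semClosure 𝐋 m Σ₀ t t')
lemma1 𝐋 F X _ Σ₀ m t t' = ⋀-antitone 𝐋 _ _ λ { (Σ' , closed , Σ₀⊆Σ') →
  (Σ' , semClosed⇒synClosed 𝐋 closed , Σ₀⊆Σ') , IsPartialOrder.refl isPartialOrder }
  where open CompleteResiduatedLattice 𝐋
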